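{- For every $k\ge1$, every permutation belonging to the basis of $B_k^{(ptd)}$ has length at most $2k+1$.
   Context: Permutations are written in one-line notation; $S_n$ is the set of permutations of length $n$. A prefix transposition of $\sigma=\sigma_1\cdots\sigma_m$ with indices $1<q<r\le m+1$ produces $\sigma_q\cdots\sigma_{r-1}\,\sigma_1\cdots\sigma_{q-1}\,\sigma_r\cdots\sigma_m$. The prefix transposition distance $ptd(\sigma)$ is the minimum number of prefix transpositions needed to transform $\sigma$ into the identity permutation of the same length. $B_k^{(ptd)}=\bigcup_{n\ge0}\{\sigma\in S_n: ptd(\sigma)\le k\}$; it is a permutation class, i.e. closed downward under the pattern order (where $\sigma$ is contained in $\tau$ if some subsequence of $\tau$ is order-isomorphic to $\sigma$). The basis of a permutation class is the set of permutations not in the class that are minimal in the pattern order among permutations not in the class. -}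

module Defs where

open import Data.Nat using (ℕ; zero; suc; _<_; _≤_; _+_; _*_)
open import Data.List using (List; []; _∷_; _++_; length; upTo; lookup)
open import Data.List.Relation.Binary.Sublist.Propositional using (_⊆_)
open import Data.List.Relation.Binary.Permutation.Propositional using (_↭_)
open import Data.Fin using (Fin; toℕ)
open import Data.Product using (Σ; ∃; ∃-syntax; _×_; _,_)
open import Relation.Binary.PropositionalEquality using (_≡_)
open import Relation.Nullary using (¬_)

-- A permutation of length n in one-line notation, using values 0,…,n-1
-- (i.e. the usual values 1..n shifted down by one).
Perm : Set
Perm = List ℕ

IsPerm : Perm → Set
IsPerm σ = σ ↭ upTo (length σ)

IsIdentity : Perm → Set
IsIdentity σ = σ ≡ upTo (length σ)

data PrefixTransp : Perm → Perm → Set where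
  ptr : ∀ (a : ℕ) (A : List ℕ) (b : ℕ) (B C : List ℕ) →
        PrefixTransp ((a ∷ A) ++ (b ∷ B) ++ C) ((b ∷ B) ++ (a ∷ A) ++ C)

data PtdLe : ℕ → Perm → Set where
  done : ∀ {k σ} → IsIdentity σ → PtdLe k σ
  step : ∀ {k σ τ} → PrefixTransp σ τ → PtdLe k τ → PtdLe (suc k) σ

InB : ℕ → Perm → Set
InB k σ = IsPerm σ × PtdLe k σ

OrderIso : List ℕ → List ℕ → Set
OrderIso xs ys =
  Σ (length xs ≡ length ys) λ eq →
    ∀ (i j : Fin (length xs)) →
      (lookup xs i < lookup xs j → lookup ys (Data.Fin.cast eq i) < lookup ys (Data.Fin.cast eq j)) ×
      (lookup ys (Data.Fin.cast eq i) < lookup ys (Data.Fin.cast eq j) → lookup xs i < lookup xs j)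

Contains : Perm → Perm → Set
Contains σ τ = ∃[ s ] (s ⊆ τ × OrderIso σ s)

InBasis : ℕ → Perm → Set
InBasis k σ =
  IsPerm σ × ¬ PtdLe k σ ×
  (∀ (π : Perm) → IsPerm π → Contains π σ → ¬ (π ≡ σ) → InB k π)

-- A breakpoint of σ is a pair of consecutive entries of σ followed by the sentinel n = |σ| that is not
-- of the form i, i+1. A prefix transposition removes at most two breakpoints, so σ has at most 2k of
-- them when ptd(σ) ≤ k. Let σ be in the basis of B_k. If σ n contained an adjacency i, i+1, deleting
-- one of its entries would give a pattern in B_k from which σ is rebuilt at no cost (by appending the
-- maximum, or by splitting the value i into i, i+1), so σ would lie in B_k. Hence all n junctions of
-- σ n are breakpoints. For n ≥ 3 one can delete 0, or a neighbour of 0, without creating an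
-- adjacency; the resulting pattern is in B_k and has n - 1 breakpoints, so n - 1 ≤ 2k.

module Submission where

open import Defs
open import Data.Nat using (ℕ; zero; suc; pred; _≤_; _<_; _+_; _*_; _∸_; z≤n; s≤s; s≤s⁻¹)
open import Data.Nat.Properties
open import Data.Nat.Tactic.RingSolver using (solve-∀)
open import Data.List using (List; []; _∷_; _++_; [_]; length; upTo; iterate; applyUpTo; concatMap; map; concat; lookup; last; head; initLast; _∷ʳ′_)
open import Data.List.Properties using (++-assoc; upTo-∷ʳ; ++-conicalˡ; length-upTo; map-++; concat-++; length-map; length-++-sucʳ; length-++; ∷-injective; ∷ʳ-injective; ++-identityʳ; map-id-local)
open import Data.List.Relation.Unary.All as All using (All; []; _∷_)
import Data.List.Relation.Unary.All.Properties as All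
open import Data.List.Relation.Unary.AllPairs using (_∷_)
open import Data.List.Relation.Unary.Linked as Linked using (Linked; []; [-]; _∷_)
import Data.List.Relation.Unary.Linked.Properties as Linked
open import Data.Maybe using (just; nothing)
open import Data.Maybe.Relation.Binary.Connected using (Connected; just; just-nothing; nothing-just; nothing)
open import Data.List.Relation.Unary.Unique.Propositional using (Unique)
open import Data.List.Relation.Unary.Unique.Propositional.Properties using (upTo⁺)
open import Data.List.Membership.Propositional using (_∈_)
open import Data.List.Membership.Propositional.Properties using (∈-lookup; ∈-upTo⁺; ∈-upTo⁻; ∈-++⁺ʳ; ∈-∃++)
open import Data.List.Relation.Unary.Any using (here; there)
open import Data.List.Relation.Binary.Sublist.Propositional using (_∷ʳ_; ⊆-refl)
import Data.List.Relation.Binary.Sublist.Propositional.Properties as Sublist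
import Data.List.Relation.Binary.Permutation.Setoid.Properties as PermutationSetoid
open import Data.Fin using (cast; zero; suc)
open import Data.List.Relation.Binary.Permutation.Propositional using (_↭_; ↭-sym; ↭⇒↭ₛ; module PermutationReasoning)
open import Data.List.Relation.Binary.Permutation.Propositional.Properties using (↭-length; shifts; shift; drop-mid; map⁺; ∈-resp-↭; ++⁺ʳ)
open import Data.Product using (∃-syntax; _×_; _,_; proj₂)
open import Data.Sum using (_⊎_; inj₁; inj₂; [_,_]′)
open import Relation.Binary.Definitions using (tri<; tri≈; tri>)
open import Relation.Nullary using (¬_; yes; no; contradiction)
open import Relation.Binary.PropositionalEquality
  using (_≡_; _≢_; refl; sym; trans; cong; cong₂; subst; subst₂; ≢-sym; setoid; module ≡-Reasoning)

applyUpTo-iterate : ∀ (f : ℕ → ℕ) i n → (∀ j → f j ≡ i + j) → applyUpTo f n ≡ iterate suc i n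
applyUpTo-iterate f i zero    f≗ = refl
applyUpTo-iterate f i (suc n) f≗ =
  cong₂ _∷_ (trans (f≗ 0) (+-identityʳ i))
            (applyUpTo-iterate (λ j → f (suc j)) (suc i) n (λ j → trans (f≗ (suc j)) (+-suc i j)))

upTo-iterate : ∀ n → upTo n ≡ iterate suc 0 n
upTo-iterate n = applyUpTo-iterate (λ j → j) 0 n (λ j → refl)

iterate-++ : ∀ i a b → iterate suc i (a + b) ≡ iterate suc i a ++ iterate suc (i + a) b
iterate-++ i zero    b = cong (λ j → iterate suc j b) (sym (+-identityʳ i))
iterate-++ i (suc a) b =
  cong (i ∷_) (trans (iterate-++ (suc i) a b) (cong (λ j → iterate suc (suc i) a ++ iterate suc j b) (sym (+-suc i a))))

upTo-around : ∀ y m → y ≤ m → upTo (suc m) ≡ iterate suc 0 y ++ y ∷ iterate suc (suc y) (m ∸ y)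
upTo-around y m y≤m = begin
  upTo (suc m)                        ≡⟨ upTo-iterate (suc m) ⟩
  iterate suc 0 (suc m)               ≡⟨ cong (iterate suc 0) (sym (trans (+-suc y (m ∸ y)) (cong suc (m+[n∸m]≡n y≤m)))) ⟩
  iterate suc 0 (y + suc (m ∸ y))     ≡⟨ iterate-++ 0 y (suc (m ∸ y)) ⟩
  iterate suc 0 y ++ y ∷ iterate suc (suc y) (m ∸ y) ∎
  where open ≡-Reasoning

++-assoc₃ : ∀ {A : Set} (X Y C Z : List A) → (X ++ Y ++ C) ++ Z ≡ X ++ Y ++ C ++ Z
++-assoc₃ X Y C Z = trans (++-assoc X (Y ++ C) Z) (cong (X ++_) (++-assoc Y C Z))

last-++ : ∀ {A : Set} (xs : List A) y ys → last (xs ++ y ∷ ys) ≡ last (y ∷ ys)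
last-++ []           y ys = refl
last-++ (x ∷ [])     y ys = refl
last-++ (x ∷ x′ ∷ xs) y ys = last-++ (x′ ∷ xs) y ys

∷ʳ-split : ∀ {A : Set} (σ : List A) n L y h t → σ ++ [ n ] ≡ L ++ y ∷ h ∷ t →
  ∃[ W ] σ ≡ L ++ y ∷ W × h ∷ t ≡ W ++ [ n ]
∷ʳ-split []      n []          y h t ()
∷ʳ-split []      n (_ ∷ [])    y h t ()
∷ʳ-split []      n (_ ∷ _ ∷ _) y h t ()
∷ʳ-split (b ∷ σ) n []          y h t eq with refl , eq′ ← ∷-injective eq = σ , refl , sym eq′
∷ʳ-split (b ∷ σ) n (a ∷ L)     y h t eq with refl , eq′ ← ∷-injective eq
  with W , refl , R≡ ← ∷ʳ-split σ n L y h t eq′ = W , refl , R≡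

length-snoc : ∀ {A : Set} (P : List A) x → length (P ++ [ x ]) ≡ suc (length P)
length-snoc P x = trans (length-++ P) (+-comm (length P) 1)

lookup-map : ∀ {A B : Set} (f : A → B) xs (eq : length (map f xs) ≡ length xs) i →
  lookup (map f xs) i ≡ f (lookup xs (cast eq i))
lookup-map f (x ∷ xs) eq zero    = refl
lookup-map f (x ∷ xs) eq (suc i) = lookup-map f xs (suc-injective eq) i

module _ {A : Set} {R : A → A → Set} where

  Linked-++⁻ : ∀ xs {ys} → Linked R (xs ++ ys) → Linked R xs × Linked R ys
  Linked-++⁻ []           rs       = [] , rs
  Linked-++⁻ (x ∷ [])     rs       = [-] , Linked.tail rs
  Linked-++⁻ (x ∷ y ∷ xs) (r ∷ rs) with rs₁ , rs₂ ← Linked-++⁻ (y ∷ xs) rs = r ∷ rs₁ , rs₂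

  Linked-delete : ∀ U y V → Linked R (U ++ y ∷ V) → Connected R (last U) (head V) → Linked R (U ++ V)
  Linked-delete U y V rs junction with rsU , rsyV ← Linked-++⁻ U rs = Linked.++⁺ rsU junction (Linked.tail rsyV)

  Linked-from : ∀ {P Q : A → Set} → (∀ {u v} → P u → Q v → R u v) →
    ∀ {x xs} → All P (x ∷ xs) → All Q xs → Linked R (x ∷ xs)
  Linked-from f (_ ∷ [])       []       = [-]
  Linked-from f (pu ∷ pv ∷ ps) (qv ∷ qs) = f pu qv ∷ Linked-from f (pv ∷ ps) qs

  Connected-to : ∀ {z} m → (∀ u → R u z) → Connected R m (just z)
  Connected-to (just u) R-z = just (R-z u)
  Connected-to nothing  R-z = nothing-just

module _ {A : Set} {R S : A → A → Set} where

  Linked-All : ∀ {P : A → Set} → (∀ {u v} → P u → P v → R u v → S u v) →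
    ∀ {xs} → All P xs → Linked R xs → Linked S xs
  Linked-All f []             []       = []
  Linked-All f (_ ∷ [])       [-]      = [-]
  Linked-All f (pu ∷ pv ∷ ps) (r ∷ rs) = f pu pv r ∷ Linked-All f (pv ∷ ps) rs

  Connected-map : (∀ {u v} → R u v → S u v) → ∀ {m m′} → Connected R m m′ → Connected S m m′
  Connected-map f (just r)     = just (f r)
  Connected-map f just-nothing = just-nothing
  Connected-map f nothing-just = nothing-just
  Connected-map f nothing      = nothing

IsPerm⇒Unique : ∀ {σ} → IsPerm σ → Unique σ
IsPerm⇒Unique {σ} σ↭ = PermutationSetoid.Unique-resp-↭ (setoid ℕ) (↭⇒↭ₛ (↭-sym σ↭)) (upTo⁺ (length σ))

IsPerm-∈⇒< : ∀ {σ v} → IsPerm σ → v ∈ σ → v < length σ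
IsPerm-∈⇒< σ↭ v∈σ = ∈-upTo⁻ (∈-resp-↭ σ↭ v∈σ)

IsPerm-<⇒∈ : ∀ {σ v} → IsPerm σ → v < length σ → v ∈ σ
IsPerm-<⇒∈ σ↭ v<n = ∈-resp-↭ (↭-sym σ↭) (∈-upTo⁺ v<n)

IsPerm-< : ∀ {σ} → IsPerm σ → All (_< length σ) σ
IsPerm-< σ↭ = All.tabulate (IsPerm-∈⇒< σ↭)

Unique-middle : ∀ U (y : ℕ) V → Unique (U ++ y ∷ V) → All (_≢ y) (U ++ V)
Unique-middle U y V unique
  with y≢ ∷ _ ← PermutationSetoid.Unique-resp-↭ (setoid ℕ) (↭⇒↭ₛ (shift y U V)) unique
  = All.map ≢-sym y≢

IsPerm-appendMax : ∀ {σ} → IsPerm σ → IsPerm (σ ++ [ length σ ])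
IsPerm-appendMax {σ} σ↭ =
  subst (λ m → σ ++ [ length σ ] ↭ upTo m) (sym (length-snoc σ (length σ)))
        (subst (σ ++ [ length σ ] ↭_) (upTo-∷ʳ (length σ)) (++⁺ʳ [ length σ ] σ↭))

≡upTo⇒IsIdentity : ∀ {xs} n → xs ≡ upTo n → IsIdentity xs
≡upTo⇒IsIdentity n xs≡ = trans xs≡ (cong upTo (sym (trans (cong length xs≡) (length-upTo n))))

-- Breakpoints

breakAt : ℕ → ℕ → ℕ
breakAt u v with v ≟ suc u
... | yes _ = 0
... | no  _ = 1

breakAt≤1 : ∀ u v → breakAt u v ≤ 1
breakAt≤1 u v with v ≟ suc u
... | yes _ = z≤n
... | no  _ = s≤s z≤n

breakAt-suc : ∀ u → breakAt u (suc u) ≡ 0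
breakAt-suc u with suc u ≟ suc u
... | yes _   = refl
... | no  u≢u = contradiction refl u≢u

breakAt-≢ : ∀ {u v} → v ≢ suc u → breakAt u v ≡ 1
breakAt-≢ {u} {v} v≢1+u with v ≟ suc u
... | yes v≡1+u = contradiction v≡1+u v≢1+u
... | no  _     = refl

breaksFrom : ℕ → List ℕ → ℕ
breaksFrom x []       = 0
breaksFrom x (y ∷ ys) = breakAt x y + breaksFrom y ys

breakpoints : List ℕ → ℕ
breakpoints []       = 0
breakpoints (x ∷ xs) = breaksFrom x xs

lastFrom : ℕ → List ℕ → ℕ
lastFrom x []       = x
lastFrom x (y ∷ ys) = lastFrom y ys

breaksFrom-++ : ∀ x A b B →
  breaksFrom x (A ++ b ∷ B) ≡ breaksFrom x A + breakAt (lastFrom x A) b + breaksFrom b B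
breaksFrom-++ x []      b B = refl
breaksFrom-++ x (y ∷ A) b B rewrite breaksFrom-++ y A b B =
  reassociate (breakAt x y) (breaksFrom y A) (breakAt (lastFrom y A) b) (breaksFrom b B)
  where
  reassociate : ∀ p q r s → p + (q + r + s) ≡ p + q + r + s
  reassociate = solve-∀

breakpoints-iterate : ∀ i n → breakpoints (iterate suc i n) ≡ 0
breakpoints-iterate i zero          = refl
breakpoints-iterate i (suc zero)    = refl
breakpoints-iterate i (suc (suc n)) =
  trans (cong (_+ breakpoints (iterate suc (suc i) (suc n))) (breakAt-suc i)) (breakpoints-iterate (suc i) (suc n))

breakpoints-upTo : ∀ n → breakpoints (upTo n) ≡ 0
breakpoints-upTo n = trans (cong breakpoints (upTo-iterate n)) (breakpoints-iterate 0 n)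

breakpoints-transposition : ∀ a A b B d D →
  breakpoints ((a ∷ A) ++ (b ∷ B) ++ d ∷ D) ≤ breakpoints ((b ∷ B) ++ (a ∷ A) ++ d ∷ D) + 2
breakpoints-transposition a A b B d D
  rewrite breaksFrom-++ a A b (B ++ d ∷ D) | breaksFrom-++ b B d D
        | breaksFrom-++ b B a (A ++ d ∷ D) | breaksFrom-++ a A d D = begin
    α + j₁ + (β + j₂ + δ)      ≡⟨ regroup α j₁ β j₂ δ ⟩
    α + β + δ + (j₁ + j₂)      ≤⟨ +-monoʳ-≤ (α + β + δ) (+-mono-≤ (breakAt≤1 _ b) (breakAt≤1 _ d)) ⟩
    α + β + δ + 2              ≤⟨ +-monoˡ-≤ 2 (m≤m+n (α + β + δ) (j₃ + j₄)) ⟩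
    α + β + δ + (j₃ + j₄) + 2  ≡⟨ cong (_+ 2) (sym (regroup′ β j₃ α j₄ δ)) ⟩
    β + j₃ + (α + j₄ + δ) + 2  ∎
  where
  open ≤-Reasoning
  α = breaksFrom a A
  β = breaksFrom b B
  δ = breaksFrom d D
  j₁ = breakAt (lastFrom a A) b
  j₂ = breakAt (lastFrom b B) d
  j₃ = breakAt (lastFrom b B) a
  j₄ = breakAt (lastFrom a A) d
  regroup : ∀ x i y j z → x + i + (y + j + z) ≡ x + y + z + (i + j)
  regroup = solve-∀
  regroup′ : ∀ y i x j z → y + i + (x + j + z) ≡ x + y + z + (i + j)
  regroup′ = solve-∀

-- No sentinel stands in front, so a prefix transposition changes only the junctions after its two blocks.
breakpoints-prefixTransp : ∀ {σ τ} m → PrefixTransp σ τ →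
  breakpoints (σ ++ [ m ]) ≤ breakpoints (τ ++ [ m ]) + 2
breakpoints-prefixTransp m (ptr a A b B C) =
  subst₂ (λ s t → breakpoints s ≤ breakpoints t + 2)
         (sym (++-assoc₃ (a ∷ A) (b ∷ B) C [ m ])) (sym (++-assoc₃ (b ∷ B) (a ∷ A) C [ m ]))
         (nonemptyTail C)
  where
  nonemptyTail : ∀ C → breakpoints ((a ∷ A) ++ (b ∷ B) ++ C ++ [ m ]) ≤ breakpoints ((b ∷ B) ++ (a ∷ A) ++ C ++ [ m ]) + 2
  nonemptyTail []      = breakpoints-transposition a A b B m []
  nonemptyTail (c ∷ C) = breakpoints-transposition a A b B c (C ++ [ m ])

prefixTransp-↭ : ∀ {σ τ} → PrefixTransp σ τ → σ ↭ τ
prefixTransp-↭ (ptr a A b B C) = shifts (a ∷ A) (b ∷ B)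

prefixTransp-length : ∀ {σ τ} → PrefixTransp σ τ → length σ ≡ length τ
prefixTransp-length t = ↭-length (prefixTransp-↭ t)

ptd-lowerBound : ∀ {k σ} → PtdLe k σ → breakpoints (σ ++ [ length σ ]) ≤ 2 * k
ptd-lowerBound {k} {σ} (done σ≡id) = ≤-trans (≤-reflexive (begin
    breakpoints (σ ++ [ length σ ])             ≡⟨ cong (λ xs → breakpoints (xs ++ [ length σ ])) σ≡id ⟩
    breakpoints (upTo (length σ) ++ [ length σ ]) ≡⟨ cong breakpoints (upTo-∷ʳ (length σ)) ⟩
    breakpoints (upTo (suc (length σ)))          ≡⟨ breakpoints-upTo (suc (length σ)) ⟩
    0                                            ∎)) z≤n
  where open ≡-Reasoning
ptd-lowerBound {suc k} {σ} (step {τ = τ} t rest) = begin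
  breakpoints (σ ++ [ length σ ]) ≤⟨ breakpoints-prefixTransp (length σ) t ⟩
  breakpoints (τ ++ [ length σ ]) + 2 ≡⟨ cong (λ m → breakpoints (τ ++ [ m ]) + 2) (prefixTransp-length t) ⟩
  breakpoints (τ ++ [ length τ ]) + 2 ≤⟨ +-monoˡ-≤ 2 (ptd-lowerBound rest) ⟩
  2 * k + 2                          ≡⟨ trans (+-comm (2 * k) 2) (sym (*-suc 2 k)) ⟩
  2 * suc k                          ∎
  where open ≤-Reasoning

-- Operations that preserve ptd ≤ k

prefixTransp-blocks : ∀ X Y Z → X ≢ [] → Y ≢ [] → PrefixTransp (X ++ Y ++ Z) (Y ++ X ++ Z)
prefixTransp-blocks []      _       _ X≢[] _    = contradiction refl X≢[]
prefixTransp-blocks (_ ∷ _) []      _ _    Y≢[] = contradiction refl Y≢[]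
prefixTransp-blocks (a ∷ A) (b ∷ B) C _    _    = ptr a A b B C

prefixTransp-++ʳ : ∀ {σ τ} Z → PrefixTransp σ τ → PrefixTransp (σ ++ Z) (τ ++ Z)
prefixTransp-++ʳ Z (ptr a A b B C) =
  subst₂ PrefixTransp (sym (++-assoc₃ (a ∷ A) (b ∷ B) C Z)) (sym (++-assoc₃ (b ∷ B) (a ∷ A) C Z))
         (ptr a A b B (C ++ Z))

appendMax-ptd : ∀ {k σ} → PtdLe k σ → PtdLe k (σ ++ [ length σ ])
appendMax-ptd {σ = σ} (done σ≡id) =
  done (≡upTo⇒IsIdentity (suc (length σ))
         (trans (cong (_++ [ length σ ]) σ≡id) (upTo-∷ʳ (length σ))))
appendMax-ptd {suc k} {σ} (step {τ = τ} t rest) =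
  step (prefixTransp-++ʳ [ length σ ] t)
       (subst (λ m → PtdLe k (τ ++ [ m ])) (sym (prefixTransp-length t)) (appendMax-ptd rest))

-- stretch x undoes the deletion of an entry x+1 that directly follows x.
stretchValue : ℕ → ℕ → List ℕ
stretchValue x v with <-cmp v x
... | tri< _ _ _ = [ v ]
... | tri≈ _ _ _ = x ∷ suc x ∷ []
... | tri> _ _ _ = [ suc v ]

stretch : ℕ → List ℕ → List ℕ
stretch x = concatMap (stretchValue x)

stretchValue-< : ∀ {x v} → v < x → stretchValue x v ≡ [ v ]
stretchValue-< {x} {v} v<x with <-cmp v x
... | tri< _ _ _   = refl
... | tri≈ v≮x _ _ = contradiction v<x v≮x
... | tri> v≮x _ _ = contradiction v<x v≮x

stretchValue-≡ : ∀ x → stretchValue x x ≡ x ∷ suc x ∷ []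
stretchValue-≡ x with <-cmp x x
... | tri< _ x≢x _ = contradiction refl x≢x
... | tri≈ _ _ _   = refl
... | tri> _ x≢x _ = contradiction refl x≢x

stretchValue-> : ∀ {x v} → x < v → stretchValue x v ≡ [ suc v ]
stretchValue-> {x} {v} x<v with <-cmp v x
... | tri< _ _ v≯x = contradiction x<v v≯x
... | tri≈ _ _ v≯x = contradiction x<v v≯x
... | tri> _ _ _   = refl

stretchValue-≢[] : ∀ x v → stretchValue x v ≢ []
stretchValue-≢[] x v with <-cmp v x
... | tri< _ _ _ = λ ()
... | tri≈ _ _ _ = λ ()
... | tri> _ _ _ = λ ()

stretch-++ : ∀ x xs ys → stretch x (xs ++ ys) ≡ stretch x xs ++ stretch x ys
stretch-++ x xs ys = trans (cong concat (map-++ (stretchValue x) xs ys))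
                           (sym (concat-++ (map (stretchValue x) xs) (map (stretchValue x) ys)))

stretch-∷-≢[] : ∀ x v xs → stretch x (v ∷ xs) ≢ []
stretch-∷-≢[] x v xs eq = stretchValue-≢[] x v (++-conicalˡ _ _ eq)

stretch-prefixTransp : ∀ {σ τ} x → PrefixTransp σ τ → PrefixTransp (stretch x σ) (stretch x τ)
stretch-prefixTransp x (ptr a A b B C) =
  subst₂ PrefixTransp (sym (stretch-++₃ (a ∷ A) (b ∷ B))) (sym (stretch-++₃ (b ∷ B) (a ∷ A)))
    (prefixTransp-blocks (stretch x (a ∷ A)) (stretch x (b ∷ B)) (stretch x C)
                         (stretch-∷-≢[] x a A) (stretch-∷-≢[] x b B))
  where
  stretch-++₃ : ∀ X Y → stretch x (X ++ Y ++ C) ≡ stretch x X ++ stretch x Y ++ stretch x C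
  stretch-++₃ X Y = trans (stretch-++ x X (Y ++ C)) (cong (stretch x X ++_) (stretch-++ x Y C))

stretch-iterate-above : ∀ {x} i n → x < i → stretch x (iterate suc i n) ≡ iterate suc (suc i) n
stretch-iterate-above i zero    x<i = refl
stretch-iterate-above {x} i (suc n) x<i =
  cong₂ _++_ (stretchValue-> x<i) (stretch-iterate-above (suc i) n (m<n⇒m<1+n x<i))

stretch-iterate : ∀ {x} i n → i ≤ x → x < i + n → stretch x (iterate suc i n) ≡ iterate suc i (suc n)
stretch-iterate {x} i zero    i≤x x<i+0 = contradiction i≤x (<⇒≱ (subst (x <_) (+-identityʳ i) x<i+0))
stretch-iterate {x} i (suc n) i≤x x<i+n with m≤n⇒m<n∨m≡n i≤x
... | inj₂ refl = cong₂ _++_ (stretchValue-≡ i) (stretch-iterate-above (suc i) n ≤-refl)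
... | inj₁ i<x  = cong₂ _++_ (stretchValue-< i<x)
                            (stretch-iterate (suc i) n i<x (subst (x <_) (+-suc i n) x<i+n))

stretch-ptd : ∀ {k σ} x → x < length σ → PtdLe k σ → PtdLe k (stretch x σ)
stretch-ptd {σ = σ} x x<n (done σ≡id) =
  done (≡upTo⇒IsIdentity (suc (length σ)) (begin
    stretch x σ                             ≡⟨ cong (stretch x) (trans σ≡id (upTo-iterate (length σ))) ⟩
    stretch x (iterate suc 0 (length σ))    ≡⟨ stretch-iterate 0 (length σ) z≤n x<n ⟩
    iterate suc 0 (suc (length σ))          ≡⟨ sym (upTo-iterate (suc (length σ))) ⟩
    upTo (suc (length σ))                   ∎))
  where open ≡-Reasoning
stretch-ptd {suc k} x x<n (step t rest) =
  step (stretch-prefixTransp x t) (stretch-ptd x (subst (x <_) (prefixTransp-length t) x<n) rest)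

-- Deleting an entry

squeeze : ℕ → ℕ → ℕ
squeeze y v with y <? v
... | yes _ = pred v
... | no  _ = v

squeeze-≤ : ∀ {y v} → v ≤ y → squeeze y v ≡ v
squeeze-≤ {y} {v} v≤y with y <? v
... | yes y<v = contradiction v≤y (<⇒≱ y<v)
... | no  _   = refl

squeeze-suc : ∀ {y w} → y ≤ w → squeeze y (suc w) ≡ w
squeeze-suc {y} {w} y≤w with y <? suc w
... | yes _   = refl
... | no  y≮ = contradiction (s≤s y≤w) y≮

data Avoids (y : ℕ) : ℕ → Set where
  below : ∀ {v} → v < y → Avoids y v
  above : ∀ {w} → y ≤ w → Avoids y (suc w)

avoids : ∀ {y v} → v ≢ y → Avoids y v
avoids {y} {v} v≢y with <-cmp v y
... | tri< v<y _ _ = below v<y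
... | tri≈ _ v≡y _ = contradiction v≡y v≢y
avoids {y} {suc w} v≢y | tri> _ _ (s≤s y≤w) = above y≤w

squeeze-< : ∀ {y u v} → Avoids y u → Avoids y v → u < v → squeeze y u < squeeze y v
squeeze-< (below u<y) (below v<y) u<v
  rewrite squeeze-≤ (<⇒≤ u<y) | squeeze-≤ (<⇒≤ v<y) = u<v
squeeze-< (below u<y) (above y≤w) _
  rewrite squeeze-≤ (<⇒≤ u<y) | squeeze-suc y≤w = <-≤-trans u<y y≤w
squeeze-< (above y≤w) (below v<y) w<v = contradiction (m≤n⇒m≤1+n y≤w) (<⇒≱ (<-trans w<v v<y))
squeeze-< (above y≤w) (above y≤w′) (s≤s w<w′)
  rewrite squeeze-suc y≤w | squeeze-suc y≤w′ = w<w′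

squeeze-<⁻ : ∀ {y u v} → Avoids y u → Avoids y v → squeeze y u < squeeze y v → u < v
squeeze-<⁻ {u = u} {v} au av su<sv with <-cmp u v
... | tri< u<v _ _ = u<v
... | tri≈ _ refl _ = contradiction su<sv (<-irrefl refl)
... | tri> _ _ v<u = contradiction su<sv (<-asym (squeeze-< av au v<u))

squeeze-adjacent⁻ : ∀ {y u v} → Avoids y u → Avoids y v → squeeze y v ≡ suc (squeeze y u) →
  v ≡ suc u ⊎ (suc u ≡ y × v ≡ suc y)
squeeze-adjacent⁻ (below u<y) (below v<y) eq
  rewrite squeeze-≤ (<⇒≤ u<y) | squeeze-≤ (<⇒≤ v<y) = inj₁ eq
squeeze-adjacent⁻ (below u<y) (above y≤w) eq
  rewrite squeeze-≤ (<⇒≤ u<y) | squeeze-suc y≤w | eq with ≤-antisym u<y y≤w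
... | refl = inj₂ (refl , refl)
squeeze-adjacent⁻ (above y≤w) (below v<y) eq
  rewrite squeeze-suc y≤w | squeeze-≤ (<⇒≤ v<y) = contradiction (m≤n⇒m≤1+n y≤w) (<⇒≱ (subst (_< _) eq v<y))
squeeze-adjacent⁻ (above y≤w) (above y≤w′) eq
  rewrite squeeze-suc y≤w | squeeze-suc y≤w′ = inj₁ (cong suc eq)

removeEntry : List ℕ → ℕ → List ℕ → Perm
removeEntry U y V = map (squeeze y) (U ++ V)

length-removeEntry : ∀ U y V → length (U ++ y ∷ V) ≡ suc (length (removeEntry U y V))
length-removeEntry U y V = trans (length-++-sucʳ U y V) (cong suc (sym (length-map (squeeze y) (U ++ V))))

squeeze-iterate-below : ∀ {y} i a → i + a ≤ y → map (squeeze y) (iterate suc i a) ≡ iterate suc i a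
squeeze-iterate-below i zero    _ = refl
squeeze-iterate-below i (suc a) i+a≤y =
  cong₂ _∷_ (squeeze-≤ (≤-trans (m≤m+n i (suc a)) i+a≤y))
            (squeeze-iterate-below (suc i) a (≤-trans (≤-reflexive (sym (+-suc i a))) i+a≤y))

squeeze-iterate-above : ∀ {y} i b → y ≤ i → map (squeeze y) (iterate suc (suc i) b) ≡ iterate suc i b
squeeze-iterate-above i zero    _   = refl
squeeze-iterate-above i (suc b) y≤i = cong₂ _∷_ (squeeze-suc y≤i) (squeeze-iterate-above (suc i) b (m≤n⇒m≤1+n y≤i))

removeEntry-IsPerm : ∀ U y V → IsPerm (U ++ y ∷ V) → IsPerm (removeEntry U y V)
removeEntry-IsPerm U y V σ↭ = begin
    map (squeeze y) (U ++ V)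
      ↭⟨ map⁺ (squeeze y) (drop-mid U (iterate suc 0 y) (subst (U ++ y ∷ V ↭_) upTo≡ σ↭)) ⟩
    map (squeeze y) (iterate suc 0 y ++ iterate suc (suc y) (m ∸ y))
      ≡⟨ map-++ (squeeze y) (iterate suc 0 y) _ ⟩
    map (squeeze y) (iterate suc 0 y) ++ map (squeeze y) (iterate suc (suc y) (m ∸ y))
      ≡⟨ cong₂ _++_ (squeeze-iterate-below 0 y ≤-refl) (squeeze-iterate-above y (m ∸ y) ≤-refl) ⟩
    iterate suc 0 y ++ iterate suc y (m ∸ y)
      ≡⟨ sym (iterate-++ 0 y (m ∸ y)) ⟩
    iterate suc 0 (y + (m ∸ y))
      ≡⟨ cong (iterate suc 0) (m+[n∸m]≡n y≤m) ⟩
    iterate suc 0 m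
      ≡⟨ sym (upTo-iterate m) ⟩
    upTo m ∎
  where
  open PermutationReasoning
  m = length (removeEntry U y V)
  y≤m : y ≤ m
  y≤m = s≤s⁻¹ (subst (y <_) (length-removeEntry U y V) (IsPerm-∈⇒< σ↭ (∈-++⁺ʳ U (here refl))))
  upTo≡ : upTo (length (U ++ y ∷ V)) ≡ iterate suc 0 y ++ y ∷ iterate suc (suc y) (m ∸ y)
  upTo≡ = trans (cong upTo (length-removeEntry U y V)) (upTo-around y m y≤m)

squeeze-OrderIso : ∀ y xs → All (_≢ y) xs → OrderIso (map (squeeze y) xs) xs
squeeze-OrderIso y xs xs≢y = eq , λ i j →
    (λ lt → squeeze-<⁻ (avoid i) (avoid j) (subst₂ _<_ (lookup-map (squeeze y) xs eq i) (lookup-map (squeeze y) xs eq j) lt))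
  , (λ lt → subst₂ _<_ (sym (lookup-map (squeeze y) xs eq i)) (sym (lookup-map (squeeze y) xs eq j))
                   (squeeze-< (avoid i) (avoid j) lt))
  where
  eq = length-map (squeeze y) xs
  avoid : ∀ i → Avoids y (lookup xs (cast eq i))
  avoid i = avoids (All.lookup xs≢y (∈-lookup (cast eq i)))

removeEntry-proper : ∀ U y V → IsPerm (U ++ y ∷ V) →
  Contains (removeEntry U y V) (U ++ y ∷ V) × removeEntry U y V ≢ U ++ y ∷ V
removeEntry-proper U y V σ↭ =
    (U ++ V , Sublist.++⁺ ⊆-refl (y ∷ʳ ⊆-refl) , squeeze-OrderIso y (U ++ V) (Unique-middle U y V (IsPerm⇒Unique σ↭)))
  , λ eq → <-irrefl (cong length eq) (≤-reflexive (sym (length-removeEntry U y V)))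

removeEntry-ptd : ∀ {k} U y V → InBasis k (U ++ y ∷ V) → PtdLe k (removeEntry U y V)
removeEntry-ptd U y V (σ↭ , _ , minimal) with contained , proper ← removeEntry-proper U y V σ↭ =
  proj₂ (minimal (removeEntry U y V) (removeEntry-IsPerm U y V σ↭) contained proper)

removeEntry-appendMax : ∀ U y W → y ≤ length (removeEntry U y W) →
  removeEntry U y (W ++ [ length (U ++ y ∷ W) ]) ≡ removeEntry U y W ++ [ length (removeEntry U y W) ]
removeEntry-appendMax U y W y≤m = begin
  map (squeeze y) (U ++ W ++ [ n ])      ≡⟨ cong (map (squeeze y)) (sym (++-assoc U W [ n ])) ⟩
  map (squeeze y) ((U ++ W) ++ [ n ])    ≡⟨ map-++ (squeeze y) (U ++ W) [ n ] ⟩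
  removeEntry U y W ++ [ squeeze y n ]   ≡⟨ cong (λ v → removeEntry U y W ++ [ v ])
                                               (trans (cong (squeeze y) (length-removeEntry U y W)) (squeeze-suc y≤m)) ⟩
  removeEntry U y W ++ [ length (removeEntry U y W) ] ∎
  where
  open ≡-Reasoning
  n = length (U ++ y ∷ W)

stretchValue-squeeze : ∀ {x v} → v ≢ x → v ≢ suc x → stretchValue x (squeeze x v) ≡ [ v ]
stretchValue-squeeze {x} {v} v≢x v≢1+x with avoids v≢x
... | below v<x = trans (cong (stretchValue x) (squeeze-≤ (<⇒≤ v<x))) (stretchValue-< v<x)
... | above {w} x≤w =
  trans (cong (stretchValue x) (squeeze-suc x≤w)) (stretchValue-> (≤∧≢⇒< x≤w (λ x≡w → v≢1+x (cong suc (sym x≡w)))))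

stretch-squeeze : ∀ x xs → All (_≢ x) xs → All (_≢ suc x) xs → stretch x (map (squeeze x) xs) ≡ xs
stretch-squeeze x []       []             []               = refl
stretch-squeeze x (v ∷ xs) (v≢x ∷ xs≢x) (v≢1+x ∷ xs≢1+x) =
  cong₂ _++_ (stretchValue-squeeze v≢x v≢1+x) (stretch-squeeze x xs xs≢x xs≢1+x)

stretch-removeEntry : ∀ P x W → Unique (P ++ x ∷ suc x ∷ W) →
  stretch x (removeEntry P x (suc x ∷ W)) ≡ P ++ x ∷ suc x ∷ W
stretch-removeEntry P x W unique = begin
  stretch x (map (squeeze x) (P ++ suc x ∷ W))
    ≡⟨ cong (stretch x) (map-++ (squeeze x) P (suc x ∷ W)) ⟩
  stretch x (map (squeeze x) P ++ squeeze x (suc x) ∷ map (squeeze x) W)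
    ≡⟨ stretch-++ x (map (squeeze x) P) _ ⟩
  stretch x (map (squeeze x) P) ++ stretchValue x (squeeze x (suc x)) ++ stretch x (map (squeeze x) W)
    ≡⟨ cong₂ _++_ (stretch-squeeze x P P≢x P≢1+x)
                  (cong₂ _++_ (trans (cong (stretchValue x) (squeeze-suc ≤-refl)) (stretchValue-≡ x))
                              (stretch-squeeze x W W≢x W≢1+x)) ⟩
  P ++ x ∷ suc x ∷ W ∎
  where
  open ≡-Reasoning
  PW≢x = Unique-middle P x (suc x ∷ W) unique
  P≢x = All.++⁻ˡ P PW≢x
  W≢x = All.tail (All.++⁻ʳ P PW≢x)
  PxW≢1+x = Unique-middle (P ++ [ x ]) (suc x) W (subst Unique (sym (++-assoc P [ x ] (suc x ∷ W))) unique)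
  P≢1+x = All.++⁻ˡ P (All.++⁻ˡ (P ++ [ x ]) PxW≢1+x)
  W≢1+x = All.++⁻ʳ (P ++ [ x ]) PxW≢1+x

-- Adjacencies in a basis element

Adjacent : ℕ → ℕ → Set
Adjacent u v = v ≡ suc u

NoAdjacency : List ℕ → Set
NoAdjacency = Linked (λ u v → ¬ Adjacent u v)

adjacency? : ∀ xs → NoAdjacency xs ⊎ ∃[ P ] ∃[ u ] ∃[ S ] xs ≡ P ++ u ∷ suc u ∷ S
adjacency? []           = inj₁ []
adjacency? (x ∷ [])     = inj₁ [-]
adjacency? (x ∷ y ∷ xs) with y ≟ suc x | adjacency? (y ∷ xs)
... | yes adj  | _                     = inj₂ ([] , x , xs , cong (λ z → x ∷ z ∷ xs) adj)
... | no  ¬adj | inj₁ noAdj            = inj₁ (¬adj ∷ noAdj)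
... | no  ¬adj | inj₂ (P , u , S , eq) = inj₂ (x ∷ P , u , S , cong (x ∷_) eq)

maxAtEnd-ptd : ∀ {k} P x → InBasis k (P ++ [ x ]) → suc x ≡ length (P ++ [ x ]) → PtdLe k (P ++ [ x ])
maxAtEnd-ptd {k} P x basis@(σ↭ , _) n≡ =
  subst (λ m → PtdLe k (P ++ [ m ])) (suc-injective (sym (trans n≡ (length-snoc P x))))
        (subst (λ xs → PtdLe k (xs ++ [ length xs ])) removeEntry≡P (appendMax-ptd (removeEntry-ptd P x [] basis)))
  where
  fixed : All (λ v → squeeze x v ≡ v) P
  fixed = All.map (λ {v} v<n → squeeze-≤ (s≤s⁻¹ (subst (v <_) (sym n≡) v<n))) (All.++⁻ˡ P (IsPerm-< σ↭))
  removeEntry≡P : removeEntry P x [] ≡ P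
  removeEntry≡P = trans (cong (map (squeeze x)) (++-identityʳ P)) (map-id-local fixed)

innerAdjacency-ptd : ∀ {k} P x W → InBasis k (P ++ x ∷ suc x ∷ W) → PtdLe k (P ++ x ∷ suc x ∷ W)
innerAdjacency-ptd {k} P x W basis@(σ↭ , _) =
  subst (PtdLe k) (stretch-removeEntry P x W (IsPerm⇒Unique σ↭))
        (stretch-ptd x x<m (removeEntry-ptd P x (suc x ∷ W) basis))
  where
  x<m : x < length (removeEntry P x (suc x ∷ W))
  x<m = s≤s⁻¹ (subst (suc x <_) (length-removeEntry P x (suc x ∷ W))
                     (IsPerm-∈⇒< σ↭ (∈-++⁺ʳ P (there (here refl)))))

basis-noAdjacency : ∀ {k σ} → InBasis k σ → NoAdjacency (σ ++ [ length σ ])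
basis-noAdjacency {k} {σ} basis@(_ , σ∉ , _) with adjacency? (σ ++ [ length σ ])
... | inj₁ noAdj = noAdj
... | inj₂ (P , x , [] , eq)
  with σ≡ , n≡ ← ∷ʳ-injective σ (P ++ [ x ]) (trans eq (sym (++-assoc P [ x ] [ suc x ])))
  = contradiction (subst (PtdLe k) (sym σ≡)
                     (maxAtEnd-ptd P x (subst (InBasis k) σ≡ basis) (trans (sym n≡) (cong length σ≡))))
                  σ∉
... | inj₂ (P , x , z ∷ S , eq)
  with W , σ≡ , _ ← ∷ʳ-split σ (length σ) (P ++ [ x ]) (suc x) z S (trans eq (sym (++-assoc P [ x ] _)))
  = contradiction (subst (PtdLe k) (sym σ≡′) (innerAdjacency-ptd P x W (subst (InBasis k) σ≡′ basis))) σ∉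
  where σ≡′ = trans σ≡ (++-assoc P [ x ] (suc x ∷ W))

breakpoints-noAdjacency : ∀ {xs} → NoAdjacency xs → breakpoints xs ≡ pred (length xs)
breakpoints-noAdjacency []             = refl
breakpoints-noAdjacency [-]            = refl
breakpoints-noAdjacency (¬adj ∷ noAdj) = cong₂ _+_ (breakAt-≢ ¬adj) (breakpoints-noAdjacency noAdj)

-- Deletions that create no adjacency

Neighbours : ℕ → ℕ → ℕ → ℕ → Set
Neighbours a b u v = (u ≡ a → v ≡ b) × (v ≡ b → u ≡ a)

neighbours-apart : ∀ {a b u v} → a ≢ u → b ≢ v → Neighbours a b u v
neighbours-apart a≢u b≢v = (λ u≡a → contradiction (sym u≡a) a≢u) , (λ v≡b → contradiction (sym v≡b) b≢v)

Unique-neighbours : ∀ X (a b : ℕ) Y → Unique (X ++ a ∷ b ∷ Y) → Linked (Neighbours a b) (X ++ a ∷ b ∷ Y)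
Unique-neighbours [] a b Y (a∉bY ∷ b∉Y ∷ _) = ((λ _ → refl) , (λ _ → refl)) ∷ Linked-from neighbours-apart a∉bY b∉Y
Unique-neighbours (x ∷ []) a b Y (x∉ ∷ unique@((a≢b ∷ _) ∷ _)) =
  neighbours-apart (≢-sym (All.lookup x∉ (here refl))) (≢-sym a≢b) ∷ Unique-neighbours [] a b Y unique
Unique-neighbours (x ∷ x′ ∷ X) a b Y (x∉ ∷ unique@(x′∉ ∷ _)) =
  neighbours-apart (≢-sym (All.lookup x∉ (∈-++⁺ʳ (x′ ∷ X) (here refl))))
                   (≢-sym (All.lookup x′∉ (∈-++⁺ʳ X (there (here refl)))))
  ∷ Unique-neighbours (x′ ∷ X) a b Y unique

squeeze-¬adjacent : ∀ {y u v} → u ≢ y → v ≢ y → ¬ Adjacent u v → ¬ (suc u ≡ y × v ≡ suc y) →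
  ¬ Adjacent (squeeze y u) (squeeze y v)
squeeze-¬adjacent u≢y v≢y ¬adj ¬gap adj = [ ¬adj , ¬gap ]′ (squeeze-adjacent⁻ (avoids u≢y) (avoids v≢y) adj)

DeletionKeeps : ℕ → ℕ → ℕ → Set
DeletionKeeps y u v = u ≢ y → v ≢ y → ¬ Adjacent (squeeze y u) (squeeze y v)

noAdjacency-removeEntry : ∀ U y V → Unique (U ++ y ∷ V) → Linked (DeletionKeeps y) (U ++ y ∷ V) →
  Connected (DeletionKeeps y) (last U) (head V) → NoAdjacency (removeEntry U y V)
noAdjacency-removeEntry U y V unique keeps junction =
  Linked.map⁺ (Linked-All (λ u≢y v≢y keep → keep u≢y v≢y) (Unique-middle U y V unique)
                          (Linked-delete U y V keeps junction))

removeZero-noAdjacency : ∀ U s T → Unique (U ++ 0 ∷ s ∷ T) → NoAdjacency (U ++ 0 ∷ s ∷ T) →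
  Connected (λ u v → ¬ Adjacent u v) (last U) (just s) → NoAdjacency (removeEntry U 0 (s ∷ T))
removeZero-noAdjacency U s T unique noAdj junction =
  noAdjacency-removeEntry U 0 (s ∷ T) unique (Linked.map keeps noAdj) (Connected-map keeps junction)
  where
  keeps : ∀ {u v} → ¬ Adjacent u v → DeletionKeeps 0 u v
  keeps ¬adj u≢0 v≢0 = squeeze-¬adjacent u≢0 v≢0 ¬adj (λ { (() , _) })

removeTwo-noAdjacency : ∀ A t T → Unique (A ++ 1 ∷ 0 ∷ 2 ∷ t ∷ T) → NoAdjacency (A ++ 1 ∷ 0 ∷ 2 ∷ t ∷ T) →
  NoAdjacency (removeEntry (A ++ 1 ∷ 0 ∷ []) 2 (t ∷ T))
removeTwo-noAdjacency A t T unique noAdj =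
  noAdjacency-removeEntry (A ++ 1 ∷ 0 ∷ []) 2 (t ∷ T) (subst Unique (sym L≡) unique)
    (subst (Linked (DeletionKeeps 2)) (sym L≡) (Linked.zipWith keeps (noAdj , Unique-neighbours A 1 0 (2 ∷ t ∷ T) unique)))
    (subst (λ m → Connected (DeletionKeeps 2) m (just t)) (sym (last-++ A 1 (0 ∷ [])))
           (just (λ _ t≢2 → squeeze-¬adjacent (λ ()) t≢2 t≢1 (λ { (() , _) }))))
  where
  L≡ = ++-assoc A (1 ∷ 0 ∷ []) (2 ∷ t ∷ T)
  t≢1 : t ≢ 1
  t≢1 = All.lookup (Unique-middle A 1 (0 ∷ 2 ∷ t ∷ T) unique) (∈-++⁺ʳ A (there (there (here refl))))
  keeps : ∀ {u v} → ¬ Adjacent u v × Neighbours 1 0 u v → DeletionKeeps 2 u v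
  keeps (¬adj , (after1 , _)) u≢2 v≢2 =
    squeeze-¬adjacent u≢2 v≢2 ¬adj (λ (2≡ , v≡3) → contradiction (trans (sym v≡3) (after1 (suc-injective 2≡))) λ ())

removeMiddle-noAdjacency : ∀ A p T → 2 ≤ p →
  Unique (A ++ p ∷ 0 ∷ suc p ∷ T) → NoAdjacency (A ++ p ∷ 0 ∷ suc p ∷ T) →
  NoAdjacency (removeEntry A p (0 ∷ suc p ∷ T))
removeMiddle-noAdjacency A p T 2≤p unique noAdj =
  noAdjacency-removeEntry A p (0 ∷ suc p ∷ T) unique
    (Linked.zipWith keeps (noAdj , subst (Linked (Neighbours 0 (suc p))) (sym L≡)
                                         (Unique-neighbours (A ++ [ p ]) 0 (suc p) T (subst Unique L≡ unique))))
    (Connected-to (last A) (λ u _ _ sq0≡ → 0≢1+n (trans (sym (squeeze-≤ {p} z≤n)) sq0≡)))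
  where
  L≡ = sym (++-assoc A [ p ] (0 ∷ suc p ∷ T))
  keeps : ∀ {u v} → ¬ Adjacent u v × Neighbours 0 (suc p) u v → DeletionKeeps p u v
  keeps (¬adj , (_ , before1+p)) u≢p v≢p =
    squeeze-¬adjacent u≢p v≢p ¬adj (λ (1+u≡p , v≡1+p) → <⇒≢ 2≤p (trans (cong suc (sym (before1+p v≡1+p))) 1+u≡p))

GoodDeletion : List ℕ → Set
GoodDeletion L = ∃[ U ] ∃[ y ] ∃[ h ] ∃[ t ] L ≡ U ++ y ∷ h ∷ t × NoAdjacency (removeEntry U y (h ∷ t))

-- Deleting 0 from between p and p + 1 would create an adjacency, so delete 2 (if p = 1) or p instead.
goodDeletion-consecutive : ∀ A p T → Unique (A ++ p ∷ 0 ∷ suc p ∷ T) → NoAdjacency (A ++ p ∷ 0 ∷ suc p ∷ T) →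
  (∀ X y → A ++ p ∷ 0 ∷ suc p ∷ T ≡ X ++ [ y ] → 3 ≤ y) → GoodDeletion (A ++ p ∷ 0 ∷ suc p ∷ T)
goodDeletion-consecutive A zero T unique _ _ =
  contradiction refl (All.lookup (Unique-middle A 0 (0 ∷ 1 ∷ T) unique) (∈-++⁺ʳ A (here refl)))
goodDeletion-consecutive A 1 [] _ _ ends≥3 =
  contradiction (ends≥3 (A ++ 1 ∷ 0 ∷ []) 2 (sym (++-assoc A (1 ∷ 0 ∷ []) [ 2 ]))) λ { (s≤s (s≤s ())) }
goodDeletion-consecutive A 1 (t ∷ T) unique noAdj _ =
  A ++ 1 ∷ 0 ∷ [] , 2 , t , T , sym (++-assoc A (1 ∷ 0 ∷ []) (2 ∷ t ∷ T)) , removeTwo-noAdjacency A t T unique noAdj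
goodDeletion-consecutive A p@(suc (suc _)) T unique noAdj _ =
  A , p , 0 , suc p ∷ T , refl , removeMiddle-noAdjacency A p T (s≤s (s≤s z≤n)) unique noAdj

goodDeletion : ∀ L → Unique L → NoAdjacency L → 0 ∈ L → (∀ X y → L ≡ X ++ [ y ] → 3 ≤ y) → GoodDeletion L
goodDeletion L unique noAdj 0∈L ends≥3 with ∈-∃++ 0∈L
... | P , [] , refl = contradiction (ends≥3 P 0 refl) λ ()
... | P , s ∷ T , refl with initLast P
...   | [] = [] , 0 , s , T , refl , removeZero-noAdjacency [] s T unique noAdj nothing-just
...   | A ∷ʳ′ p with s ≟ suc p
...     | no s≢1+p =
  A ++ [ p ] , 0 , s , T , refl ,
  removeZero-noAdjacency (A ++ [ p ]) s T unique noAdj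
    (subst (λ m → Connected (λ u v → ¬ Adjacent u v) m (just s)) (sym (last-++ A p [])) (just s≢1+p))
...     | yes refl =
  subst GoodDeletion (sym L≡)
    (goodDeletion-consecutive A p T (subst Unique L≡ unique) (subst NoAdjacency L≡ noAdj)
                              (λ X y e → ends≥3 X y (trans L≡ e)))
  where L≡ = ++-assoc A [ p ] (0 ∷ suc p ∷ T)

appendMax-goodDeletion : ∀ {σ} → IsPerm σ → 3 ≤ length σ → NoAdjacency (σ ++ [ length σ ]) →
  GoodDeletion (σ ++ [ length σ ])
appendMax-goodDeletion {σ} σ↭ 3≤n noAdj = goodDeletion (σ ++ [ length σ ]) (IsPerm⇒Unique σ′↭) noAdj 0∈σ′ ends≥3
  where
  σ′↭ = IsPerm-appendMax σ↭
  0∈σ′ : 0 ∈ σ ++ [ length σ ]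
  0∈σ′ = IsPerm-<⇒∈ σ′↭ (subst (0 <_) (sym (length-snoc σ (length σ))) (s≤s z≤n))
  ends≥3 : ∀ X y → σ ++ [ length σ ] ≡ X ++ [ y ] → 3 ≤ y
  ends≥3 X y e = subst (3 ≤_) (proj₂ (∷ʳ-injective σ X e)) 3≤n

basis-shortPattern : ∀ {k σ} → InBasis k σ → 3 ≤ length σ →
  ∃[ π ] PtdLe k π × NoAdjacency (π ++ [ length π ]) × suc (length π) ≡ length σ
basis-shortPattern {k} {σ} basis@(σ↭ , _) 3≤n
  with U , y , h , t , L≡ , noAdj ← appendMax-goodDeletion σ↭ 3≤n (basis-noAdjacency basis)
  with W , refl , ht≡ ← ∷ʳ-split σ (length σ) U y h t L≡
  = removeEntry U y W
  , removeEntry-ptd U y W basis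
  , subst NoAdjacency (removeEntry-appendMax U y W y≤m) (subst (λ R → NoAdjacency (removeEntry U y R)) ht≡ noAdj)
  , sym (length-removeEntry U y W)
  where
  y≤m : y ≤ length (removeEntry U y W)
  y≤m = s≤s⁻¹ (subst (y <_) (length-removeEntry U y W) (IsPerm-∈⇒< σ↭ (∈-++⁺ʳ U (here refl))))

mainTheorem8 : ∀ (k : ℕ) → 1 ≤ k → ∀ (σ : Perm) → InBasis k σ → length σ ≤ 2 * k + 1
mainTheorem8 k 1≤k σ basis with 3 ≤? length σ
... | no  n≱3 = ≤-trans (s≤s⁻¹ (≰⇒> n≱3)) (≤-trans (*-monoʳ-≤ 2 1≤k) (m≤m+n (2 * k) 1))
... | yes 3≤n with π , π-ptd , noAdj , len≡ ← basis-shortPattern basis 3≤n = begin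
  length σ                              ≡⟨ sym len≡ ⟩
  suc (length π)                        ≡⟨ cong suc (sym breakpoints≡) ⟩
  suc (breakpoints (π ++ [ length π ])) ≤⟨ s≤s (ptd-lowerBound π-ptd) ⟩
  suc (2 * k)                           ≡⟨ +-comm 1 (2 * k) ⟩
  2 * k + 1                             ∎
  where
  open ≤-Reasoning
  breakpoints≡ = trans (breakpoints-noAdjacency noAdj) (cong pred (length-snoc π (length π)))
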